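{- Let $G$ be an abelian group (written additively), $\phi$ an automorphism of $G$, and $K$ a subgroup of index $2$ in $G$. Then $K$ is $\phi$-invariant if and only if $\mathrm{Im}_G(1+\phi)\leqslant K$.
   Context: For an endomorphism $f$ of $G$, $\mathrm{Im}_G(f)=\{f(g):g\in G\}$; here $(1+\phi)(g)=g+\phi(g)$. -}

module Defs where

open import Level using (Level; _⊔_; suc)
open import Algebra.Bundles using (AbelianGroup)
open import Algebra.Morphism.Structures using (module GroupMorphisms)
open import Data.Product using (Σ; _×_)
open import Data.Sum using (_⊎_)
open import Relation.Nullary using (¬_)

module _ {c ℓ : Level} (G : AbelianGroup c ℓ) where
  open AbelianGroup G renaming (_∙_ to _+_; ε to 0#; _⁻¹ to -_)

  IsAutomorphism : (Carrier → Carrier) → Set (c ⊔ ℓ)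
  IsAutomorphism φ = GroupMorphisms.IsGroupIsomorphism rawGroup rawGroup φ

  record IsSubgroup {k : Level} (K : Carrier → Set k) : Set (c ⊔ ℓ ⊔ k) where
    field
      resp   : ∀ {x y} → x ≈ y → K x → K y
      zero∈  : K 0#
      +-clos : ∀ {x y} → K x → K y → K (x + y)
      neg-clos : ∀ {x} → K x → K (- x)

  -- K has index 2: there are exactly two cosets, K and g + K for some g ∉ K.
  HasIndex2 : {k : Level} → (Carrier → Set k) → Set (c ⊔ k)
  HasIndex2 K = Σ Carrier λ g → ¬ K g × (∀ x → K x ⊎ K (x + (- g)))

  IsInvariant : {k : Level} → (Carrier → Carrier) → (Carrier → Set k) → Set (c ⊔ k)
  IsInvariant φ K = ∀ x → K x → K (φ x)

  ImOnePlusLe : {k : Level} → (Carrier → Carrier) → (Carrier → Set k) → Set (c ⊔ k)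
  ImOnePlusLe φ K = ∀ g → K (g + φ g)

-- Because K has index 2, membership in K is decidable and the sum of two
-- elements outside K lies in K. If K is φ-invariant then so is its complement:
-- φ is onto, so some y has φ y = g ∉ K, whence y ∉ K; for x ∉ K with φ x ∈ K we
-- would get g ≈ φ (y − x) + φ x ∈ K, since y − x ∈ K. Hence x + φ x ∈ K whether
-- or not x ∈ K. Conversely φ x = (x + φ x) − x lies in K for every x ∈ K.
module Submission where

open import Defs
open import Level using (Level)
open import Algebra.Bundles using (AbelianGroup)
open import Algebra.Morphism.Structures using (module GroupMorphisms)
open import Data.Empty using (⊥-elim)
open import Data.Product using (_,_; proj₁; proj₂)
open import Data.Sum using (_⊎_; inj₁; inj₂)
open import Function.Base using (_∘_)
open import Function.Bundles using (_⇔_; mk⇔)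
open import Function.Definitions using (Surjective)
open import Relation.Nullary using (¬_; yes; no)
open import Relation.Unary using (Decidable)
import Algebra.Properties.AbelianGroup as AbelianGroupProperties
import Relation.Binary.Reasoning.Setoid as SetoidReasoning

module _ {c ℓ : Level} (G : AbelianGroup c ℓ) where
  open AbelianGroup G renaming (_∙_ to _+_; _⁻¹ to -_)
  open AbelianGroupProperties G
    using (⁻¹-involutive; \\-leftDividesʳ; //-rightDividesˡ; //-rightDividesʳ; xyx⁻¹≈y)
  open SetoidReasoning setoid

  module _ {k : Level} {K : Carrier → Set k} (K-sub : IsSubgroup G K) where
    open IsSubgroup K-sub

    -‿clos : ∀ {x y} → K x → K y → K (x - y)
    -‿clos kx ky = +-clos kx (neg-clos ky)

    neg-∈⇒∈ : ∀ {x} → K (- x) → K x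
    neg-∈⇒∈ {x} k-x = resp (⁻¹-involutive x) (neg-clos k-x)

    ∈-cancelˡ : ∀ {x y} → K x → K (x + y) → K y
    ∈-cancelˡ {x} {y} kx kx+y = resp (\\-leftDividesʳ x y) (+-clos (neg-clos kx) kx+y)

    ∈-cancelʳ : ∀ {x y} → K y → K (x + y) → K x
    ∈-cancelʳ {x} {y} ky kx+y = resp (//-rightDividesʳ y x) (-‿clos kx+y ky)

    imOnePlusLe⇒isInvariant : (φ : Carrier → Carrier) → ImOnePlusLe G φ K → IsInvariant G φ K
    imOnePlusLe⇒isInvariant φ im x kx = resp (xyx⁻¹≈y x (φ x)) (-‿clos (im x) kx)

    module _ (K-index2 : HasIndex2 G K) where
      private
        g : Carrier
        g = proj₁ K-index2

        g∉K : ¬ K g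
        g∉K = proj₁ (proj₂ K-index2)

        K-or-K-g : ∀ x → K x ⊎ K (x - g)
        K-or-K-g = proj₂ (proj₂ K-index2)

      K? : Decidable K
      K? x with K-or-K-g x
      ... | inj₁ kx   = yes kx
      ... | inj₂ kx-g = no λ kx → g∉K (neg-∈⇒∈ (∈-cancelˡ kx kx-g))

      ∉⇒-g∈ : ∀ {x} → ¬ K x → K (x - g)
      ∉⇒-g∈ {x} x∉K with K-or-K-g x
      ... | inj₁ kx   = ⊥-elim (x∉K kx)
      ... | inj₂ kx-g = kx-g

      ∉-∉⇒-∈ : ∀ {x y} → ¬ K x → ¬ K y → K (x - y)
      ∉-∉⇒-∈ {x} {y} x∉K y∉K = ∈-cancelʳ (∉⇒-g∈ y∉K) (resp telescope (∉⇒-g∈ x∉K))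
        where
        telescope : x - g ≈ (x - y) + (y - g)
        telescope = sym (begin
          (x - y) + (y - g)    ≈⟨ assoc x (- y) (y - g) ⟩
          x + (- y + (y - g))  ≈⟨ ∙-congˡ (\\-leftDividesʳ y (- g)) ⟩
          x - g                ∎)

      ∉-∉⇒+∈ : ∀ {x y} → ¬ K x → ¬ K y → K (x + y)
      ∉-∉⇒+∈ {x} {y} x∉K y∉K =
        resp (∙-congˡ (⁻¹-involutive y)) (∉-∉⇒-∈ x∉K (y∉K ∘ neg-∈⇒∈))

      module _ {φ : Carrier → Carrier}
               (φ-hom : GroupMorphisms.IsGroupHomomorphism rawGroup rawGroup φ)
               (φ-surj : Surjective _≈_ _≈_ φ) where
        open GroupMorphisms.IsGroupHomomorphism φ-hom using (homo; ⟦⟧-cong)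

        isInvariant⇒∉-invariant : IsInvariant G φ K → ∀ {x} → ¬ K x → ¬ K (φ x)
        isInvariant⇒∉-invariant inv {x} x∉K kφx with φ-surj g
        ... | y , φy≈g with K? y
        ...   | yes ky  = g∉K (resp (φy≈g refl) (inv y ky))
        ...   | no y∉K  = g∉K (resp (trans φ[y-x]+φx≈φy (φy≈g refl))
                                    (+-clos (inv (y - x) (∉-∉⇒-∈ y∉K x∉K)) kφx))
          where
          φ[y-x]+φx≈φy : φ (y - x) + φ x ≈ φ y
          φ[y-x]+φx≈φy = trans (sym (homo (y - x) x)) (⟦⟧-cong (//-rightDividesˡ x y))

        isInvariant⇒imOnePlusLe : IsInvariant G φ K → ImOnePlusLe G φ K
        isInvariant⇒imOnePlusLe inv x with K? x
        ... | yes kx  = +-clos kx (inv x kx)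
        ... | no x∉K  = ∉-∉⇒+∈ x∉K (isInvariant⇒∉-invariant inv x∉K)

mainTheorem4 : {c ℓ k : Level} (G : AbelianGroup c ℓ) (φ : AbelianGroup.Carrier G → AbelianGroup.Carrier G)
    → IsAutomorphism G φ
    → (K : AbelianGroup.Carrier G → Set k) → IsSubgroup G K → HasIndex2 G K
    → IsInvariant G φ K ⇔ ImOnePlusLe G φ K
mainTheorem4 G φ φ-aut K K-sub K-index2 =
  mk⇔ (isInvariant⇒imOnePlusLe G K-sub K-index2 isGroupHomomorphism surjective)
      (imOnePlusLe⇒isInvariant G K-sub φ)
  where open GroupMorphisms.IsGroupIsomorphism φ-aut using (isGroupHomomorphism; surjective)
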